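{- The wheel $W_7$ is a pairwise compatibility graph.
   Context: The wheel $W_7$ is the graph on $7$ vertices obtained by joining one vertex to all six vertices of a cycle of length six. A graph $G=(V,E)$ is a pairwise compatibility graph (PCG) if there exist a tree $T$, a function $w$ assigning positive real weights to the edges of $T$, and non-negative reals $d_{min}\le d_{max}$, such that the vertices of $G$ correspond bijectively to the leaves of $T$ ($u\mapsto l_u$) and for all distinct $u,v\in V$, $(u,v)\in E$ if and only if $d_{min}\le d_{T,w}(l_u,l_v)\le d_{max}$, where $d_{T,w}(l_u,l_v)$ is the sum of the weights on the path between $l_u$ and $l_v$ in $T$. -}

module Defs where

open import Data.Nat using (ℕ; zero; suc; _≤_; _≡ᵇ_; _%_) renaming (_+_ to _+ℕ_)
open import Data.Bool using (Bool; true; false; _∨_)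
open import Data.Fin using (Fin; zero; suc; toℕ)
open import Data.List using (List; []; _∷_)
open import Data.List.Relation.Unary.Unique.Propositional using (Unique)
open import Data.Rational using (ℚ; 0ℚ; _+_) renaming (_≤_ to _≤ℚ_; _<_ to _<ℚ_)
open import Data.Product using (Σ; ∃; _×_; _,_)
open import Relation.Binary.PropositionalEquality using (_≡_; _≢_)
open import Relation.Nullary using (¬_)
open import Function.Bundles using (_⇔_)

data Walk {m : ℕ} (E : Fin m → Fin m → Bool) : Fin m → Fin m → Set where
  []  : ∀ {x} → Walk E x x
  _∷_ : ∀ {x y z} → E x y ≡ true → Walk E y z → Walk E x z

len : ∀ {m} {E : Fin m → Fin m → Bool} {x y} → Walk E x y → ℕ
len []      = 0
len (_ ∷ p) = suc (len p)

verts : ∀ {m} {E : Fin m → Fin m → Bool} {x y} → Walk E x y → List (Fin m)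
verts {x = x} []      = x ∷ []
verts {x = x} (_ ∷ p) = x ∷ verts p

IsPath : ∀ {m} {E : Fin m → Fin m → Bool} {x y} → Walk E x y → Set
IsPath p = Unique (verts p)

weight : ∀ {m} {E : Fin m → Fin m → Bool} (w : Fin m → Fin m → ℚ) {x y} →
         Walk E x y → ℚ
weight w []                   = 0ℚ
weight w (_∷_ {x} {y} _ p)    = w x y + weight w p

record WTree : Set where
  field
    m        : ℕ
    E        : Fin m → Fin m → Bool
    w        : Fin m → Fin m → ℚ
    irrefl   : ∀ x → E x x ≡ false
    symE     : ∀ x y → E x y ≡ E y x
    symw     : ∀ x y → E x y ≡ true → w x y ≡ w y x
    wpos     : ∀ x y → E x y ≡ true → 0ℚ <ℚ w x y
    connected : ∀ x y → Σ (Walk E x y) IsPath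
    acyclic  : ¬ (Σ (Fin m) λ x → Σ (Fin m) λ y → E x y ≡ true ×
                  Σ (Walk E y x) λ p → IsPath p × (2 ≤ len p))

IsLeaf : (T : WTree) → Fin (WTree.m T) → Set
IsLeaf T x = Σ (Fin m) λ y → E x y ≡ true × (∀ z → E x z ≡ true → z ≡ y)
  where open WTree T

IsPCG : ∀ {n} → (Fin n → Fin n → Bool) → Set
IsPCG {n} G =
  Σ WTree λ T →
  Σ (Fin n → Fin (WTree.m T)) λ l →
  Σ ℚ λ dmin → Σ ℚ λ dmax →
    (0ℚ ≤ℚ dmin) × (dmin ≤ℚ dmax) ×
    (∀ u → IsLeaf T (l u)) ×
    (∀ u v → l u ≡ l v → u ≡ v) ×
    (∀ x → IsLeaf T x → Σ (Fin n) λ u → l u ≡ x) ×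
    (∀ u v → u ≢ v → (p : Walk (WTree.E T) (l u) (l v)) → IsPath p →
       (G u v ≡ true ⇔ (dmin ≤ℚ weight (WTree.w T) p × weight (WTree.w T) p ≤ℚ dmax)))

-- The wheel W_7: vertex 0 is the hub, vertices 1..6 form a 6-cycle
-- 1-2-3-4-5-6-1.

cyc6 : Fin 6 → Fin 6 → Bool
cyc6 i j = (((toℕ i +ℕ 1) % 6) ≡ᵇ toℕ j) ∨ (((toℕ j +ℕ 1) % 6) ≡ᵇ toℕ i)

W7 : Fin 7 → Fin 7 → Bool
W7 zero    zero    = false
W7 zero    (suc _) = true
W7 (suc _) zero    = true
W7 (suc i) (suc j) = cyc6 i j

-- W7 is realised on a tree whose root has three children: the hub sits below
-- one child together with cycle vertex 2, cycle vertices 1, 4, 5 below another,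
-- and 3, 6 below the third. With leaf depths 15, 6, 26, 3, 20, 10, 18 the hub is
-- at distance 18–35 from every cycle vertex, consecutive cycle vertices are at
-- distance 20–32, and all other pairs are at distance at most 17 or at least 36.
-- To read off tree distances from arbitrary paths, a candidate metric d is
-- certified by local conditions: a path that leaves p towards c never returns,
-- so every later step still points away from p, and its weight telescopes to d.
-- All remaining conditions concern finitely many vertices and are decided.
module Submission where

open import Defs

open import Data.Bool using (Bool; true; false; not; _∧_; _∨_; if_then_else_)
import Data.Bool.Properties as Bool
open import Data.Empty using (⊥-elim)
open import Data.Fin using (Fin; _↑ˡ_; #_)
open import Data.Fin.Properties using (_≟_; all?; any?; ↑ˡ-injective)
import Data.Integer as ℤ
open import Data.List using (List; []; _∷_; iterate; filter; map)
import Data.List.Membership.DecPropositional as DecMembership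
open import Data.List.Relation.Unary.All using (All; _∷_)
open import Data.List.Relation.Unary.AllPairs using (_∷_)
open import Data.List.Relation.Unary.Unique.Propositional using (Unique)
import Data.List.Relation.Unary.Unique.DecPropositional as DecUnique
open import Data.Maybe as Maybe using (Maybe; just; nothing)
open import Data.Maybe.Relation.Unary.Any as MaybeAny using (satisfied)
import Data.Nat as ℕ
open import Data.Nat using (ℕ; zero; suc; s≤s) renaming (_≤_ to _≤ℕ_)
open import Data.Nat.ListAction using (sum)
open import Data.Product using (Σ; _×_; _,_; proj₂; uncurry)
open import Data.Rational using (ℚ; 0ℚ; _+_; _≤_; _<_)
import Data.Rational.Properties as ℚ
open import Data.Rational.Literals using (fromℤ)
open import Data.Vec using (lookup; []; _∷_)
open import Function.Bundles using (_⇔_; mk⇔; Equivalence)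
open import Relation.Binary.PropositionalEquality using (_≡_; _≢_; refl; sym; trans; cong; subst; module ≡-Reasoning)
open import Relation.Nullary using (¬_; Dec; does; yes; no; ¬?)
open import Relation.Nullary.Decidable as Dec using (from-yes; _×-dec_; _→-dec_)

module TreeMetric {m : ℕ} (E : Fin m → Fin m → Bool) (w d : Fin m → Fin m → ℚ) where

  Via : Fin m → Fin m → Fin m → Set
  Via x z y = d x y ≡ w x z + d z y

  via? : ∀ x z y → Dec (Via x z y)
  via? x z y = d x y ℚ.≟ w x z + d z y

  Adjacent : Fin m → Fin m → Set
  Adjacent x y = E x y ≡ true

  adjacent? : ∀ x y → Dec (Adjacent x y)
  adjacent? x y = E x y Bool.≟ true

  record IsTreeMetric : Set where
    field
      d-diag     : ∀ x → d x x ≡ 0ℚ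
      d-edge     : ∀ x y → Adjacent x y → d x y ≡ w x y
      via-extend : ∀ p c → Adjacent p c → ∀ z → Adjacent c z → p ≢ z →
                   ∀ y → Via c z y → Via p c y

  greedyWalk : ℕ → ∀ x y → Maybe (Walk E x y)
  greedyWalk zero    x y = nothing
  greedyWalk (suc k) x y with x ≟ y
  ... | yes refl = just []
  ... | no _ with any? (λ z → adjacent? x z ×-dec via? x z y)
  ...   | yes (z , x~z , _) = Maybe.map (x~z ∷_) (greedyWalk k z y)
  ...   | no _              = nothing

  All-verts-last : ∀ {P : Fin m → Set} {x y} (r : Walk E x y) → All P (verts r) → P y
  All-verts-last []      (py ∷ _)  = py
  All-verts-last (_ ∷ r) (_ ∷ Pr) = All-verts-last r Pr

  All-verts-head : ∀ {P : Fin m → Set} {x y} (r : Walk E x y) → All P (verts r) → P x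
  All-verts-head []      (px ∷ _) = px
  All-verts-head (_ ∷ _) (px ∷ _) = px

  module _ (M : IsTreeMetric) where
    open IsTreeMetric M

    via-weight : ∀ {x z y} → Via x z y → (r : Walk E z y) → weight w r ≡ d z y →
                 w x z + weight w r ≡ d x y
    via-weight {x} {z} x→z→y _ r≡d = trans (cong (w x z +_) r≡d) (sym x→z→y)

    via-edge : ∀ {x y} → Adjacent x y → Via x y y
    via-edge {x} {y} x~y = begin
      d x y        ≡⟨ d-edge x y x~y ⟩
      w x y        ≡⟨ sym (ℚ.+-identityʳ (w x y)) ⟩
      w x y + 0ℚ   ≡⟨ cong (w x y +_) (sym (d-diag y)) ⟩
      w x y + d y y ∎
      where open ≡-Reasoning

    weight-via : ∀ {p c y} → Adjacent p c → (r : Walk E c y) →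
                 All (p ≢_) (verts r) → Unique (verts r) →
                 weight w r ≡ d c y × Via p c y
    weight-via {c = c} p~c [] _ _ = sym (d-diag c) , via-edge p~c
    weight-via {p} {c} p~c (c~z ∷ r) (_ ∷ p∉r) (c∉r ∷ r-path) =
      let r≡d , c→z→y = weight-via c~z r c∉r r-path in
      via-weight c→z→y r r≡d , via-extend p c p~c _ c~z (All-verts-head r p∉r) _ c→z→y

    path-weight : ∀ {x y} (r : Walk E x y) → IsPath r → weight w r ≡ d x y
    path-weight {x} []         _                = sym (d-diag x)
    path-weight     (x~z ∷ r) (x∉r ∷ r-path) =
      let r≡d , x→z→y = weight-via x~z r x∉r r-path in via-weight x→z→y r r≡d

    module _ (symE : ∀ x y → E x y ≡ E y x) (w-pos : ∀ x y → Adjacent x y → 0ℚ < w x y) where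

      -- Otherwise Via x y x would give 0 = d x x = w x y + w y x > 0.
      via-backtrack : ∀ {x y z} → Adjacent x y → Adjacent y z → Via y z x → x ≡ z
      via-backtrack {x} {y} {z} x~y y~z y→z→x with x ≟ z
      ... | yes x≡z = x≡z
      ... | no  x≢z = ⊥-elim (ℚ.<-irrefl 0≡sum (ℚ.+-mono-< (w-pos x y x~y) (w-pos y x y~x)))
        where
        y~x : Adjacent y x
        y~x = trans (symE y x) x~y
        0≡sum : 0ℚ ≡ w x y + w y x
        0≡sum = begin
          0ℚ            ≡⟨ sym (d-diag x) ⟩
          d x x         ≡⟨ via-extend x y x~y z y~z x≢z x y→z→x ⟩
          w x y + d y x ≡⟨ cong (w x y +_) (d-edge y x y~x) ⟩
          w x y + w y x ∎
          where open ≡-Reasoning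

      acyclic : ¬ (Σ (Fin m) λ x → Σ (Fin m) λ y → Adjacent x y ×
                   Σ (Walk E y x) λ r → IsPath r × (2 ≤ℕ len r))
      acyclic (x , y , x~y , y~z ∷ r , y∉r ∷ r-path , _)
        with via-backtrack x~y y~z (proj₂ (weight-via y~z r y∉r r-path))
      acyclic (x , y , x~y , y~x ∷ []      , _ , s≤s ())    | refl
      acyclic (x , y , x~y , y~x ∷ (_ ∷ r) , _ ∷ (x∉r ∷ _) , _) | refl =
        All-verts-last r x∉r refl

fromℕ : ℕ → ℚ
fromℕ n = fromℤ (ℤ.+ n)

-- A rooted tree given by parent pointers (the root is its own parent) and the
-- weight of the edge from each vertex to its parent.
module RootedTree {n : ℕ} (parent : Fin n → Fin n) (up : Fin n → ℕ) where
  open DecMembership (_≟_ {n}) using (_∉?_)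

  edge : Fin n → Fin n → Bool
  edge x y = not (does (x ≟ y)) ∧ (does (parent x ≟ y) ∨ does (parent y ≟ x))

  edgeWeight : Fin n → Fin n → ℚ
  edgeWeight x y = fromℕ (if does (parent x ≟ y) then up x else up y)

  ancestors : Fin n → List (Fin n)
  ancestors x = iterate parent x n

  -- The path from a to b consists of the parent edges of the vertices that are
  -- ancestors of exactly one of a and b.
  distance : Fin n → Fin n → ℚ
  distance a b = fromℕ (climb a b ℕ.+ climb b a)
    where
    climb : Fin n → Fin n → ℕ
    climb a b = sum (map up (filter (_∉? ancestors b) (ancestors a)))

  edge-irrefl : ∀ x → edge x x ≡ false
  edge-irrefl x with x ≟ x
  ... | yes _   = refl
  ... | no  x≢x = ⊥-elim (x≢x refl)

  edge-sym : ∀ x y → edge x y ≡ edge y x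
  edge-sym x y with x ≟ y | y ≟ x
  ... | yes _   | yes _   = refl
  ... | yes x≡y | no  y≢x = ⊥-elim (y≢x (sym x≡y))
  ... | no  x≢y | yes y≡x = ⊥-elim (x≢y (sym y≡x))
  ... | no  _   | no  _   = Bool.∨-comm (does (parent x ≟ y)) (does (parent y ≟ x))

-- Leaves 0–6 carry the wheel's vertices (0 is the hub); 7 is the root, with
-- children 8, 9, 10.
parent : Fin 11 → Fin 11
parent = lookup (# 9 ∷ # 8 ∷ # 9 ∷ # 10 ∷ # 8 ∷ # 8 ∷ # 10 ∷ # 7 ∷ # 7 ∷ # 7 ∷ # 7 ∷ [])

up : Fin 11 → ℕ
up = lookup (5 ∷ 1 ∷ 16 ∷ 1 ∷ 15 ∷ 5 ∷ 16 ∷ 0 ∷ 5 ∷ 10 ∷ 2 ∷ [])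

open RootedTree parent up
open TreeMetric edge edgeWeight distance
open DecUnique (_≟_ {11}) using (unique?)

isTreeMetric : IsTreeMetric
isTreeMetric = record
  { d-diag     = from-yes (all? λ x → distance x x ℚ.≟ 0ℚ)
  ; d-edge     = from-yes (all? λ x → all? λ y → adjacent? x y →-dec distance x y ℚ.≟ edgeWeight x y)
  ; via-extend = from-yes (all? λ p → all? λ c → adjacent? p c →-dec
                           all? λ z → adjacent? c z →-dec ¬? (p ≟ z) →-dec
                           all? λ y → via? c z y →-dec via? p c y)
  }

tree : WTree
tree = record
  { m         = 11
  ; E         = edge
  ; w         = edgeWeight
  ; irrefl    = edge-irrefl
  ; symE      = edge-sym
  ; symw      = from-yes (all? λ x → all? λ y → adjacent? x y →-dec edgeWeight x y ℚ.≟ edgeWeight y x)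
  ; wpos      = edgeWeight-pos
  ; connected = λ x y → satisfied (greedyWalk-isPath x y)
  ; acyclic   = acyclic isTreeMetric edge-sym edgeWeight-pos
  }
  where
  edgeWeight-pos : ∀ x y → Adjacent x y → 0ℚ < edgeWeight x y
  edgeWeight-pos = from-yes (all? λ x → all? λ y → adjacent? x y →-dec 0ℚ ℚ.<? edgeWeight x y)

  greedyWalk-isPath : ∀ x y → MaybeAny.Any IsPath (greedyWalk 11 x y)
  greedyWalk-isPath = from-yes (all? λ x → all? λ y → MaybeAny.dec (λ r → unique? (verts r)) (greedyWalk 11 x y))

isLeaf? : ∀ x → Dec (IsLeaf tree x)
isLeaf? x = any? λ y → adjacent? x y ×-dec all? λ z → adjacent? x z →-dec z ≟ y

leaf : Fin 7 → Fin 11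
leaf u = u ↑ˡ 4

dmin dmax : ℚ
dmin = fromℕ 18
dmax = fromℕ 35

InRange : ℚ → Set
InRange t = dmin ≤ t × t ≤ dmax

compatible : ∀ u v → u ≢ v → W7 u v ≡ true ⇔ InRange (distance (leaf u) (leaf v))
compatible = from-yes (all? λ u → all? λ v → ¬? (u ≟ v) →-dec
  Dec.map′ (uncurry mk⇔) (λ e → Equivalence.to e , Equivalence.from e)
    ((W7 u v Bool.≟ true →-dec inRange? u v) ×-dec (inRange? u v →-dec W7 u v Bool.≟ true)))
  where
  inRange? : ∀ u v → Dec (InRange (distance (leaf u) (leaf v)))
  inRange? u v = dmin ℚ.≤? distance (leaf u) (leaf v) ×-dec distance (leaf u) (leaf v) ℚ.≤? dmax

lemma3 : IsPCG W7
lemma3 = tree , leaf , dmin , dmax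
       , from-yes (0ℚ ℚ.≤? dmin)
       , from-yes (dmin ℚ.≤? dmax)
       , from-yes (all? λ u → isLeaf? (leaf u))
       , (λ u v → ↑ˡ-injective 4 u v)
       , from-yes (all? λ x → isLeaf? x →-dec any? λ u → leaf u ≟ x)
       , λ u v u≢v r r-path →
           subst (λ t → W7 u v ≡ true ⇔ InRange t) (sym (path-weight isTreeMetric r r-path)) (compatible u v u≢v)
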